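{- Let $S$ be a nonempty set of states. (1) If $\theta \subseteq \mathcal{P}(S) \times \mathcal{P}(S)$ is a transition system over $S$ and $Y \subseteq S$, then $\mathrm{reach}(\theta, Y) = \{X ~|~ (X, Y) \in \theta\}$ is a trump over $S$. (2) Conversely, for any trump $\mathcal X$ over $S$ there exists a transition system $\theta$ over $S$ such that $\mathcal X = \mathrm{reach}(\theta, Y)$ for every nonempty $Y \subseteq S$.
   Context: $\mathcal{P}(S)$ denotes the powerset of $S$. A transition system over $S$ is a nonempty relation $\theta \subseteq \mathcal{P}(S) \times \mathcal{P}(S)$ such that: (Downwards Closure) if $(X, Y) \in \theta$ and $X' \subseteq X$ then $(X', Y) \in \theta$; (Monotonicity) if $(X, Y) \in \theta$ and $Y \subseteq Y'$ then $(X, Y') \in \theta$; (Non-creation) $(\emptyset, Y) \in \theta$ for all $Y \subseteq S$; (Non-triviality) if $X \neq \emptyset$ then $(X, \emptyset) \notin \theta$. A trump over $S$ is a nonempty, downwards closed family of subsets of $S$. -}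

module Defs where

open import Level using (0ℓ)
open import Data.Product using (Σ; ∃; _×_; _,_)
open import Data.Empty using (⊥)
open import Relation.Nullary using (¬_)
open import Relation.Unary using (Pred; _⊆_; Satisfiable; Empty)

Subset : Set → Set₁
Subset S = Pred S 0ℓ

Family : Set → Set₂
Family S = Subset S → Set₁

Rel𝒫 : Set → Set₂
Rel𝒫 S = Subset S → Subset S → Set₁

record IsTransitionSystem {S : Set} (θ : Rel𝒫 S) : Set₂ where
  field
    nonempty       : Σ (Subset S) λ X → Σ (Subset S) λ Y → θ X Y
    downwardClosed : ∀ {X X' Y} → θ X Y → X' ⊆ X → θ X' Y
    monotone       : ∀ {X Y Y'} → θ X Y → Y ⊆ Y' → θ X Y'
    nonCreation    : ∀ (Y : Subset S) → θ (λ _ → ⊥) Y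
    nonTriviality  : ∀ (X : Subset S) → Satisfiable X → ¬ θ X (λ _ → ⊥)

record IsTrump {S : Set} (𝒳 : Family S) : Set₂ where
  field
    nonempty       : Σ (Subset S) λ X → 𝒳 X
    downwardClosed : ∀ {X X'} → 𝒳 X → X' ⊆ X → 𝒳 X'

reach : {S : Set} → Rel𝒫 S → Subset S → Family S
reach θ Y = λ X → θ X Y

_≐_ : {S : Set} → Family S → Family S → Set₁
_≐_ {S} 𝒳 𝒴 = ∀ (X : Subset S) → (𝒳 X → 𝒴 X) × (𝒴 X → 𝒳 X)

-- Downward closure of θ in its first argument is exactly downward closure of each reach θ Y,
-- and non-creation puts ∅ into it. Conversely, a trump 𝒳 becomes the transition system
-- relating X to every nonempty Y when X ∈ 𝒳, and ∅ to everything; a trump contains ∅, so for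
-- nonempty Y its reach is 𝒳 again.
module Submission where

open import Defs
open import Data.Product using (_×_; Σ; _,_; proj₂)
open import Data.Unit using (⊤)
open import Data.Empty using (⊥; ⊥-elim)
open import Data.Sum using (_⊎_; inj₁; inj₂)
open import Level using (Lift; lift; 0ℓ; suc)
open import Relation.Unary using (Satisfiable; Empty)

reach-isTrump : {S : Set} {θ : Rel𝒫 S} → IsTransitionSystem θ → (Y : Subset S) → IsTrump (reach θ Y)
reach-isTrump ts Y = record
  { nonempty       = (λ _ → ⊥) , nonCreation Y
  ; downwardClosed = downwardClosed
  }
  where open IsTransitionSystem ts

module _ {S : Set} {𝒳 : Family S} (trump : IsTrump 𝒳) where
  open IsTrump trump

  empty∈trump : {X : Subset S} → Empty X → 𝒳 X
  empty∈trump {X} X-empty = downwardClosed (proj₂ nonempty) (λ {x} x∈X → ⊥-elim (X-empty x x∈X))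

  fromTrump : Rel𝒫 S
  fromTrump X Y = (Satisfiable Y × 𝒳 X) ⊎ Lift (suc 0ℓ) (Empty X)

  fromTrump-isTransitionSystem : IsTransitionSystem fromTrump
  fromTrump-isTransitionSystem = record
    { nonempty       = (λ _ → ⊥) , (λ _ → ⊥) , ∅-related
    ; downwardClosed = λ where
        (inj₁ (Y-sat , X∈𝒳)) X'⊆X → inj₁ (Y-sat , downwardClosed X∈𝒳 X'⊆X)
        (inj₂ (lift X-empty)) X'⊆X → inj₂ (lift (λ x x∈X' → X-empty x (X'⊆X x∈X')))
    ; monotone       = λ where
        (inj₁ ((y , y∈Y) , X∈𝒳)) Y⊆Y' → inj₁ ((y , Y⊆Y' y∈Y) , X∈𝒳)
        (inj₂ X-empty)            _    → inj₂ X-empty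
    ; nonCreation    = λ _ → ∅-related
    ; nonTriviality  = λ where
        _ _       (inj₁ ((_ , ()) , _))
        _ (x , x∈X) (inj₂ (lift X-empty)) → X-empty x x∈X
    }
    where
    ∅-related : {Y : Subset S} → fromTrump (λ _ → ⊥) Y
    ∅-related = inj₂ (lift (λ _ ()))

  reach-fromTrump : (Y : Subset S) → Satisfiable Y → 𝒳 ≐ reach fromTrump Y
  reach-fromTrump Y Y-sat X = (λ X∈𝒳 → inj₁ (Y-sat , X∈𝒳)) , λ where
    (inj₁ (_ , X∈𝒳))      → X∈𝒳
    (inj₂ (lift X-empty)) → empty∈trump X-empty

mainTheorem9 : (S : Set) → Satisfiable {A = S} (λ _ → ⊤)
    → ((θ : Rel𝒫 S) → IsTransitionSystem θ → (Y : Subset S) → IsTrump (reach θ Y))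
    × ((𝒳 : Family S) → IsTrump 𝒳
    → Σ (Rel𝒫 S) (λ θ → IsTransitionSystem θ
    × ((Y : Subset S) → Satisfiable Y → 𝒳 ≐ reach θ Y)))
mainTheorem9 S _ =
    (λ _ → reach-isTrump)
  , λ _ trump → fromTrump trump , fromTrump-isTransitionSystem trump , reach-fromTrump trump
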